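{- Let $E$ be the elliptic curve $y^2=x^3+D(ax+b)^2$ with $a,b,D\in\mathbb{Z}$, $D\neq1$ a fundamental discriminant, $b>0$, $4Da^3\neq 27b$, and such that writing $b=b_1b_3^3$ with $b_1$ cubefree we have $\gcd(a,b_3)=1$. Let $K=\mathbb{Q}(\sqrt D)$, $\tau$ the nontrivial automorphism of $K$, $G_3$ the subgroup of $K^*/{K^*}^3$ of classes $[u]$ with $u\tau(u)\in{\mathbb{Q}^*}^3$, and $\alpha:E(\mathbb{Q})\to G_3$ given by $\alpha(O)=1$ and $\alpha((x,y))=[y-(ax+b)\sqrt D]$. (1) A class $[u]\in G_3$ belongs to the image of $\alpha$ if and only if for some (equivalently, any) representative $u\in K^*$ of the form $u=v^2\tau(v)$, with $v=v_1+v_2\sqrt D$, $v_1,v_2\in\mathbb{Q}$, the homogeneous cubic equation $$2v_2X^3+2Dv_1Y^3+\frac{2b}{v_1^2-Dv_2^2}Z^3+6v_1X^2Y+6v_2DXY^2+2a(X^2Z-DY^2Z)=0$$ has a nontrivial integer (equivalently, rational) solution. (2) More precisely, for $u=1$ (i.e. $v=1$) it has the solution $(X,Y,Z)=(1,0,0)$, and if $(x,y)\in E(\mathbb{Q})$ satisfies $y-(ax+b)\sqrt D=v^2\tau(v)z^3$ for some $z=z_1+z_2\sqrt D\in K^*$ ($z_1,z_2\in\mathbb{Q}$), it has the solution $(X,Y,Z)=(z_1,z_2,1)$. Conversely, if $(X,Y,Z)$ is a solution with $Z\neq0$, then $$(x,y)=\left(v\tau(v)\frac{X^2-DY^2}{Z^2},\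 v\tau(v)\frac{\Re\big(v(X+Y\sqrt D)^3\big)}{Z^3}\right)$$ is a preimage of $[u]$ in $E(\mathbb{Q})$, with $y-(ax+b)\sqrt D=u z^3$ for $z=(X+Y\sqrt D)/Z$.
   Context: Here $\Re(\beta)$ denotes $(\beta+\tau(\beta))/2$ for $\beta\in K$. $O$ is the point at infinity. Solutions of homogeneous equations are understood to be nontrivial. -}

module Defs where

open import Data.Nat as ℕ using (ℕ)
open import Data.Nat.Divisibility as ℕD using ()
open import Data.Nat.GCD using (gcd)
open import Data.Integer as ℤ using (ℤ; +_; ∣_∣)
open import Data.Rational as ℚ using (ℚ; 0ℚ; 1ℚ; ½; _/_; 1/_; ≢-nonZero)
open import Data.Rational.Properties using () renaming (_≟_ to _≟ℚ_)
open import Data.Product using (Σ; ∃; _×_; _,_)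
open import Data.Sum using (_⊎_)
open import Relation.Nullary using (¬_; yes; no)
open import Relation.Binary.PropositionalEquality using (_≡_; _≢_)

ι : ℤ → ℚ
ι z = z / 1

SquareFree : ℤ → Set
SquareFree m = ∀ (n : ℕ) → (n ℕ.* n) ℕD.∣ ∣ m ∣ → n ≡ 1

CubeFree : ℕ → Set
CubeFree m = ∀ (n : ℕ) → (n ℕ.* n ℕ.* n) ℕD.∣ m → n ≡ 1

FundamentalDiscriminant : ℤ → Set
FundamentalDiscriminant D =
  ((∃ λ k → D ≡ ℤ.+ 4 ℤ.* k ℤ.+ ℤ.+ 1) × SquareFree D)
  ⊎ (∃ λ m → D ≡ ℤ.+ 4 ℤ.* m
       × ((∃ λ k → m ≡ ℤ.+ 4 ℤ.* k ℤ.+ ℤ.+ 2) ⊎ (∃ λ k → m ≡ ℤ.+ 4 ℤ.* k ℤ.+ ℤ.+ 3))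
       × SquareFree m)

-- Total inverse on ℚ (inv0 0 = 0); only ever applied to nonzero arguments
-- in the theorem.

inv0 : ℚ → ℚ
inv0 p with p ≟ℚ 0ℚ
... | yes _ = 0ℚ
... | no ne = 1/_ p {{≢-nonZero ne}}

record K : Set where
  constructor _+√D·_
  field
    re : ℚ
    im : ℚ
open K public

0K 1K : K
0K = 0ℚ +√D· 0ℚ
1K = 1ℚ +√D· 0ℚ

module _ (D : ℤ) where
  _+K_ : K → K → K
  (a +√D· b) +K (c +√D· d) = (a ℚ.+ c) +√D· (b ℚ.+ d)

  _*K_ : K → K → K
  (a +√D· b) *K (c +√D· d) =
    (a ℚ.* c ℚ.+ ι D ℚ.* b ℚ.* d) +√D· (a ℚ.* d ℚ.+ b ℚ.* c)

  τ : K → K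
  τ (a +√D· b) = a +√D· (ℚ.- b)

  cubeK : K → K
  cubeK z = z *K (z *K z)

  ℜ : K → ℚ
  ℜ β = ½ ℚ.* re (β +K τ β)

  normK : K → ℚ
  normK v = re (v *K τ v)

module Curve (a b D : ℤ) where

  OnE : ℚ → ℚ → Set
  OnE x y = y ℚ.* y ≡ x ℚ.* x ℚ.* x ℚ.+ ι D ℚ.* ((ι a ℚ.* x ℚ.+ ι b) ℚ.* (ι a ℚ.* x ℚ.+ ι b))

  data Point : Set where
    O   : Point
    aff : (x y : ℚ) → OnE x y → Point

  αxy : ℚ → ℚ → K
  αxy x y = y +√D· (ℚ.- (ι a ℚ.* x ℚ.+ ι b))

  α : Point → K
  α O = 1K
  α (aff x y _) = αxy x y

  -- [u] ∈ K*/K*³ lies in the image of α: some α(P) equals u times a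
  -- nonzero cube
  InImage : K → Set
  InImage u = ∃ λ (P : Point) → ∃ λ (w : K) → w ≢ 0K × α P ≡ _*K_ D u (cubeK D w)

  Cubic : K → ℚ → ℚ → ℚ → ℚ
  Cubic v X Y Z =
        c 2 ℚ.* v₂ ℚ.* (X ℚ.* X ℚ.* X)
    ℚ.+ c 2 ℚ.* ι D ℚ.* v₁ ℚ.* (Y ℚ.* Y ℚ.* Y)
    ℚ.+ (c 2 ℚ.* ι b) ℚ.* inv0 (v₁ ℚ.* v₁ ℚ.- ι D ℚ.* v₂ ℚ.* v₂) ℚ.* (Z ℚ.* Z ℚ.* Z)
    ℚ.+ c 6 ℚ.* v₁ ℚ.* (X ℚ.* X ℚ.* Y)
    ℚ.+ c 6 ℚ.* v₂ ℚ.* ι D ℚ.* (X ℚ.* Y ℚ.* Y)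
    ℚ.+ c 2 ℚ.* ι a ℚ.* (X ℚ.* X ℚ.* Z ℚ.- ι D ℚ.* (Y ℚ.* Y ℚ.* Z))
    where
      v₁ = re v
      v₂ = im v
      c : ℕ → ℚ
      c n = ι (+ n)

  HasRatSol : K → Set
  HasRatSol v = ∃ λ X → ∃ λ Y → ∃ λ Z →
    ¬ (X ≡ 0ℚ × Y ≡ 0ℚ × Z ≡ 0ℚ) × Cubic v X Y Z ≡ 0ℚ

  HasIntSol : K → Set
  HasIntSol v = ∃ λ (X : ℤ) → ∃ λ (Y : ℤ) → ∃ λ (Z : ℤ) →
    ¬ (X ≡ + 0 × Y ≡ + 0 × Z ≡ + 0) × Cubic v (ι X) (ι Y) (ι Z) ≡ 0ℚ

module Submission where

-- Everything reduces to one polynomial identity in K = ℚ(√D).  For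
-- u = v²τ(v) = N(v)·v and w = X + Y√D, the cubic of the theorem satisfies
--     N(v) · Cubic(v; X, Y, Z) = 2 (Im(u w³) + a Z N(v) N(w) + b Z³)   (scaled-cubic),
-- while a point (x, y) lies on E exactly when N(α(x, y)) = x³ (on-curve⇔norm).
-- Hence, for α(x, y) = u z³, comparing norms gives x = N(v) N(z) (injectivity
-- of cubing on ℚ), and comparing imaginary parts gives the affine solution
-- (z₁, z₂, 1); conversely an affine solution defines the point
-- (N(v) N(z), Re(u z³)).  A solution at infinity makes u w³ a rational q with
-- q² = N(u w³) a nonzero cube, so q itself is a cube and [u] = α(O).
-- Integral solutions come from rational ones by homogeneity.

open import Defs
open import Data.Nat as ℕ using (ℕ; suc; s≤s; z≤n)
import Data.Nat.Properties as ℕP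
open import Data.Nat.Divisibility as ℕD using (divides; >⇒∤)
import Data.Nat.Coprimality as Coprimality
open import Data.Nat.GCD using (gcd)
open import Data.Integer as ℤ using (ℤ; +_; -[1+_]; ∣_∣; _*_; _^_; _>_)
import Data.Integer.Properties as ℤP
open import Data.Rational as Q using (ℚ; 0ℚ; 1ℚ; ½; mkℚ; ↥_; ↧_; toℚᵘ)
import Data.Rational.Properties as QP
open import Data.Rational.Unnormalised as U using (mkℚᵘ; *≡*)
import Data.Rational.Unnormalised.Properties as UP
open import Data.Rational.Solver using (module +-*-Solver)
open import Algebra.Apartness.Properties.HeytingCommutativeRing QP.heytingCommutativeRing
  using (x#0y#0→xy#0)
open import Data.Product using (∃; _×_; _,_; proj₁; proj₂)
open import Data.Sum using (_⊎_; inj₁; inj₂)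
open import Data.Empty using (⊥-elim)
open import Function.Bundles using (_⇔_; mk⇔; Equivalence)
open import Function.Construct.Composition using (_⇔-∘_)
open import Function.Construct.Symmetry using (⇔-sym)
open import Algebra.Properties.Group QP.+-0-group using (inverseˡ-unique)
open import Relation.Nullary using (¬_; yes; no)
open import Relation.Binary.PropositionalEquality
open +-*-Solver
open ≡-Reasoning

*-≢0 : ∀ {p q} → p ≢ 0ℚ → q ≢ 0ℚ → p Q.* q ≢ 0ℚ
*-≢0 = x#0y#0→xy#0

cancel-≢0 : ∀ {p q} → p ≢ 0ℚ → p Q.* q ≡ 0ℚ → q ≡ 0ℚ
cancel-≢0 {p} {q} p≢0 pq≡0 with q QP.≟ 0ℚ
... | yes q≡0 = q≡0
... | no q≢0 = ⊥-elim (*-≢0 p≢0 q≢0 pq≡0)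

inv0-inverse : ∀ {p} → p ≢ 0ℚ → p Q.* inv0 p ≡ 1ℚ
inv0-inverse {p} p≢0 with p QP.≟ 0ℚ
... | yes p≡0 = ⊥-elim (p≢0 p≡0)
... | no p≢0' = QP.*-inverseʳ p {{Q.≢-nonZero p≢0'}}

inverse-unique : ∀ {p r} → p Q.* r ≡ 1ℚ → inv0 p ≡ r
inverse-unique {p} {r} pr≡1 = begin
  inv0 p                     ≡⟨ sym (QP.*-identityʳ (inv0 p)) ⟩
  inv0 p Q.* 1ℚ              ≡⟨ cong (inv0 p Q.*_) (sym pr≡1) ⟩
  inv0 p Q.* (p Q.* r)       ≡⟨ solve 3 (λ p r i → i :* (p :* r) := (p :* i) :* r) refl p r (inv0 p) ⟩
  (p Q.* inv0 p) Q.* r       ≡⟨ cong (Q._* r) (inv0-inverse p≢0) ⟩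
  1ℚ Q.* r                   ≡⟨ QP.*-identityˡ r ⟩
  r                          ∎
  where
  p≢0 : p ≢ 0ℚ
  p≢0 p≡0 = QP.1≢0 (trans (sym pr≡1) (trans (cong (Q._* r) p≡0) (QP.*-zeroˡ r)))

inv0-* : ∀ {p q} → p ≢ 0ℚ → q ≢ 0ℚ → inv0 (p Q.* q) ≡ inv0 p Q.* inv0 q
inv0-* {p} {q} p≢0 q≢0 = inverse-unique {p Q.* q} (begin
  (p Q.* q) Q.* (inv0 p Q.* inv0 q) ≡⟨ solve 4 (λ p q i j → (p :* q) :* (i :* j) := (p :* i) :* (q :* j)) refl p q (inv0 p) (inv0 q) ⟩
  (p Q.* inv0 p) Q.* (q Q.* inv0 q) ≡⟨ cong₂ Q._*_ (inv0-inverse p≢0) (inv0-inverse q≢0) ⟩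
  1ℚ Q.* 1ℚ                         ≡⟨⟩
  1ℚ                                ∎)

inv0-cancel : ∀ {Z} → Z ≢ 0ℚ → ∀ X → X Q.* inv0 Z Q.* Z ≡ X
inv0-cancel {Z} Z≢0 X = begin
  X Q.* inv0 Z Q.* Z     ≡⟨ QP.*-assoc X (inv0 Z) Z ⟩
  X Q.* (inv0 Z Q.* Z)   ≡⟨ cong (X Q.*_) (trans (QP.*-comm (inv0 Z) Z) (inv0-inverse Z≢0)) ⟩
  X Q.* 1ℚ               ≡⟨ QP.*-identityʳ X ⟩
  X                      ∎

square-nonneg : ∀ p → 0ℚ Q.≤ p Q.* p
square-nonneg p@(mkℚ (+ _) _ _) = QP.nonNegative⁻¹ (p Q.* p) {{QP.nonNeg*nonNeg⇒nonNeg p p}}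
square-nonneg p@(mkℚ -[1+ _ ] _ _) =
  subst (0ℚ Q.≤_) (solve 1 (λ p → (:- p) :* (:- p) := p :* p) refl p)
    (QP.nonNegative⁻¹ ((Q.- p) Q.* (Q.- p)) {{QP.nonNeg*nonNeg⇒nonNeg (Q.- p) (Q.- p)}})

square-zero : ∀ {p} → p Q.* p ≡ 0ℚ → p ≡ 0ℚ
square-zero {p} pp≡0 with p QP.≟ 0ℚ
... | yes p≡0 = p≡0
... | no p≢0 = ⊥-elim (*-≢0 p≢0 p≢0 pp≡0)

nonneg-sum-zero : ∀ {p q} → 0ℚ Q.≤ p → 0ℚ Q.≤ q → p Q.+ q ≡ 0ℚ → p ≡ 0ℚ
nonneg-sum-zero {p} {q} 0≤p 0≤q p+q≡0 =
  QP.≤-antisym (subst₂ Q._≤_ (QP.+-identityʳ p) p+q≡0 (QP.+-monoʳ-≤ p 0≤q)) 0≤p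

-- The quadratic form x² + xt + t² is positive definite: since
-- 4(x² + xt + t²) = 3t² + (2x + t)², it vanishes only for x = t = 0.
positive-definite : ∀ {x t} → x Q.* x Q.+ x Q.* t Q.+ t Q.* t ≡ 0ℚ → x ≡ 0ℚ × t ≡ 0ℚ
positive-definite {x} {t} quadratic≡0 = x≡0 , t≡0
  where
  s = x Q.+ x Q.+ t
  3t² = t Q.* t Q.+ t Q.* t Q.+ t Q.* t
  0≤3t² : 0ℚ Q.≤ 3t²
  0≤3t² = QP.+-mono-≤ (QP.+-mono-≤ (square-nonneg t) (square-nonneg t)) (square-nonneg t)
  sum≡0 : 3t² Q.+ s Q.* s ≡ 0ℚ
  sum≡0 = begin
    3t² Q.+ s Q.* s  ≡⟨ solve 2 (λ x t → (t :* t :+ t :* t :+ t :* t) :+ (x :+ x :+ t) :* (x :+ x :+ t)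
                                 := con (ι (+ 4)) :* (x :* x :+ x :* t :+ t :* t)) refl x t ⟩
    ι (+ 4) Q.* (x Q.* x Q.+ x Q.* t Q.+ t Q.* t) ≡⟨ cong (ι (+ 4) Q.*_) quadratic≡0 ⟩
    ι (+ 4) Q.* 0ℚ   ≡⟨⟩
    0ℚ               ∎
  t≡0 : t ≡ 0ℚ
  t≡0 = square-zero (cancel-≢0 {ι (+ 3)} (λ ())
          (trans (solve 1 (λ t → con (ι (+ 3)) :* (t :* t) := t :* t :+ t :* t :+ t :* t) refl t)
                 (nonneg-sum-zero 0≤3t² (square-nonneg s) sum≡0)))
  s≡0 : s ≡ 0ℚ
  s≡0 = square-zero (nonneg-sum-zero (square-nonneg s) 0≤3t² (trans (QP.+-comm (s Q.* s) 3t²) sum≡0))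
  x≡0 : x ≡ 0ℚ
  x≡0 = begin
    x                      ≡⟨ solve 2 (λ x t → x := con ½ :* ((x :+ x :+ t) :- t)) refl x t ⟩
    ½ Q.* (s Q.- t)        ≡⟨ cong₂ (λ s t → ½ Q.* (s Q.- t)) s≡0 t≡0 ⟩
    ½ Q.* (0ℚ Q.- 0ℚ)      ≡⟨⟩
    0ℚ                     ∎

-- Cubing is injective on ℚ: if x³ = t³ then (x − t)(x² + xt + t²) = 0, and the
-- second factor vanishes only when x = t = 0.
cube-injective : ∀ {x t} → x Q.* x Q.* x ≡ t Q.* t Q.* t → x ≡ t
cube-injective {x} {t} x³≡t³ with x Q.- t QP.≟ 0ℚ
... | yes x-t≡0 = begin
  x                ≡⟨ solve 2 (λ x t → x := (x :- t) :+ t) refl x t ⟩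
  (x Q.- t) Q.+ t  ≡⟨ cong (Q._+ t) x-t≡0 ⟩
  0ℚ Q.+ t         ≡⟨ QP.+-identityˡ t ⟩
  t                ∎
... | no x-t≢0 = let x≡0 , t≡0 = positive-definite quadratic≡0 in trans x≡0 (sym t≡0)
  where
  quadratic≡0 : x Q.* x Q.+ x Q.* t Q.+ t Q.* t ≡ 0ℚ
  quadratic≡0 = cancel-≢0 x-t≢0 (begin
    (x Q.- t) Q.* (x Q.* x Q.+ x Q.* t Q.+ t Q.* t)
      ≡⟨ solve 2 (λ x t → (x :- t) :* (x :* x :+ x :* t :+ t :* t) := x :* x :* x :- t :* t :* t) refl x t ⟩
    x Q.* x Q.* x Q.- t Q.* t Q.* t ≡⟨ cong (Q._- t Q.* t Q.* t) x³≡t³ ⟩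
    t Q.* t Q.* t Q.- t Q.* t Q.* t ≡⟨ QP.+-inverseʳ (t Q.* t Q.* t) ⟩
    0ℚ                              ∎)

cube-root : ∀ {q c} → c ≢ 0ℚ → q Q.* q ≡ c Q.* c Q.* c →
            (q Q.* inv0 c) Q.* (q Q.* inv0 c) Q.* (q Q.* inv0 c) ≡ q
cube-root {q} {c} c≢0 q²≡c³ = begin
  (q Q.* i) Q.* (q Q.* i) Q.* (q Q.* i) ≡⟨ solve 2 (λ q i → (q :* i) :* (q :* i) :* (q :* i) := q :* (q :* q) :* (i :* i :* i)) refl q i ⟩
  q Q.* (q Q.* q) Q.* (i Q.* i Q.* i)   ≡⟨ cong (λ r → q Q.* r Q.* (i Q.* i Q.* i)) q²≡c³ ⟩
  q Q.* (c Q.* c Q.* c) Q.* (i Q.* i Q.* i) ≡⟨ solve 3 (λ q c i → q :* (c :* c :* c) :* (i :* i :* i) := q :* ((c :* i) :* (c :* i) :* (c :* i))) refl q c i ⟩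
  q Q.* ((c Q.* i) Q.* (c Q.* i) Q.* (c Q.* i)) ≡⟨ cong (λ r → q Q.* (r Q.* r Q.* r)) (inv0-inverse c≢0) ⟩
  q Q.* 1ℚ                              ≡⟨ QP.*-identityʳ q ⟩
  q                                     ∎
  where i = inv0 c

ι-as-fraction : ∀ m → toℚᵘ (ι m) U.≃ mkℚᵘ m 0
ι-as-fraction m = QP.toℚᵘ-fromℚᵘ (mkℚᵘ m 0)

ι-injective : ∀ {m n} → ι m ≡ ι n → m ≡ n
ι-injective {m} {n} ιm≡ιn
  with UP.≃-trans (UP.≃-sym (ι-as-fraction m)) (UP.≃-trans (QP.toℚᵘ-cong ιm≡ιn) (ι-as-fraction n))
... | *≡* m*1≡n*1 = trans (sym (ℤP.*-identityʳ m)) (trans m*1≡n*1 (ℤP.*-identityʳ n))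

ι-* : ∀ m n → ι (m ℤ.* n) ≡ ι m Q.* ι n
ι-* m n = QP.toℚᵘ-injective (UP.≃-trans (ι-as-fraction (m ℤ.* n)) (UP.≃-sym
  (UP.≃-trans (QP.toℚᵘ-homo-* (ι m) (ι n)) (UP.*-cong (ι-as-fraction m) (ι-as-fraction n)))))

ι-denominator : ∀ p → p Q.* ι (↧ p) ≡ ι (↥ p)
ι-denominator p@(mkℚ n d-1 _) = QP.toℚᵘ-injective (UP.≃-trans (QP.toℚᵘ-homo-* p (ι (↧ p)))
  (UP.≃-trans (UP.*-cong (UP.≃-refl {mkℚᵘ n d-1}) (ι-as-fraction (↧ p)))
  (UP.≃-trans (*≡* (trans (ℤP.*-identityʳ _) (cong (λ k → n ℤ.* + k) (sym (ℕP.*-identityʳ (suc d-1))))))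
  (UP.≃-sym (ι-as-fraction n)))))

ι-denominator-≢0 : ∀ p → ι (↧ p) ≢ 0ℚ
ι-denominator-≢0 (mkℚ _ d-1 _) d≡0 with ι-injective {+ suc d-1} {+ 0} d≡0
... | ()

square-abs : ∀ n → n ℤ.* n ≡ + (∣ n ∣ ℕ.* ∣ n ∣)
square-abs (+ k)    = ℤP.+◃n≡+n (k ℕ.* k)
square-abs -[1+ k ] = refl

-- A rational square that is an integer m is the square of a natural number:
-- writing p = n/d in lowest terms, n² = m d² forces d ∣ n, hence d = 1.
rational-square-integer : ∀ p m → p Q.* p ≡ ι m → m ≡ + (∣ ↥ p ∣ ℕ.* ∣ ↥ p ∣)
rational-square-integer p@(mkℚ n d-1 coprime) m p²≡m = begin
  m                     ≡⟨ sym (ℤP.*-identityʳ m) ⟩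
  m ℤ.* + 1             ≡⟨ cong (λ e → m ℤ.* + (e ℕ.* e)) (sym d≡1) ⟩
  m ℤ.* + (d ℕ.* d)     ≡⟨ sym n²≡md² ⟩
  n ℤ.* n               ≡⟨ square-abs n ⟩
  + (∣ n ∣ ℕ.* ∣ n ∣)   ∎
  where
  d = suc d-1
  n²≡md² : n ℤ.* n ≡ m ℤ.* + (d ℕ.* d)
  n²≡md² with UP.≃-trans (UP.≃-sym (QP.toℚᵘ-homo-* p p))
                (UP.≃-trans (QP.toℚᵘ-cong p²≡m) (ι-as-fraction m))
  ... | *≡* eq = trans (sym (ℤP.*-identityʳ _)) eq
  d∣n² : d ℕD.∣ ∣ n ∣ ℕ.* ∣ n ∣
  d∣n² = divides (∣ m ∣ ℕ.* d) (begin
    ∣ n ∣ ℕ.* ∣ n ∣       ≡⟨ sym (ℤP.abs-* n n) ⟩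
    ∣ n ℤ.* n ∣           ≡⟨ cong ∣_∣ n²≡md² ⟩
    ∣ m ℤ.* + (d ℕ.* d) ∣ ≡⟨ ℤP.abs-* m (+ (d ℕ.* d)) ⟩
    ∣ m ∣ ℕ.* (d ℕ.* d)   ≡⟨ sym (ℕP.*-assoc ∣ m ∣ d d) ⟩
    ∣ m ∣ ℕ.* d ℕ.* d     ∎)
  d≡1 : d ≡ 1
  d≡1 = Coprimality.recompute coprime
          (Coprimality.coprime-divisor (Coprimality.sym (Coprimality.recompute coprime)) d∣n² , ℕD.∣-refl)

NonSquare : ℤ → Set
NonSquare D = ∀ p → p Q.* p ≢ ι D

squarefree-square : ∀ {p m} → SquareFree m → p Q.* p ≡ ι m → m ≡ + 1
squarefree-square {p} {m} sf p²≡m =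
  trans m≡k² (cong (λ e → + (e ℕ.* e)) (sf k (subst (λ e → k ℕ.* k ℕD.∣ ∣ e ∣) (sym m≡k²) ℕD.∣-refl)))
  where
  k = ∣ ↥ p ∣
  m≡k² = rational-square-integer p m p²≡m

-- 1 is congruent neither to 2 nor to 3 modulo 4: otherwise 4 divides 1 or 2.
not-one-mod-four : ∀ k j → j ℕ.< 2 → + 4 ℤ.* k ℤ.+ + suc (suc j) ≢ + 1
not-one-mod-four k j j<2 4k+2+j≡1 = >⇒∤ (ℕP.m<n⇒m<1+n (s≤s j<2)) 4∣1+j
  where
  r = + suc (suc j)
  4k≡-1-j : + 4 ℤ.* k ≡ -[1+ j ]
  4k≡-1-j = begin
    + 4 ℤ.* k                      ≡⟨ sym (ℤP.+-identityʳ _) ⟩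
    + 4 ℤ.* k ℤ.+ + 0              ≡⟨ cong (λ e → + 4 ℤ.* k ℤ.+ e) (sym (ℤP.+-inverseʳ r)) ⟩
    + 4 ℤ.* k ℤ.+ (r ℤ.- r)        ≡⟨ sym (ℤP.+-assoc (+ 4 ℤ.* k) r (ℤ.- r)) ⟩
    + 4 ℤ.* k ℤ.+ r ℤ.- r          ≡⟨ cong (ℤ._- r) 4k+2+j≡1 ⟩
    + 1 ℤ.- r                      ≡⟨⟩
    -[1+ j ]                       ∎
  4∣1+j : 4 ℕD.∣ suc j
  4∣1+j = divides ∣ k ∣ (trans (sym (cong ∣_∣ 4k≡-1-j))
            (trans (ℤP.abs-* (+ 4) k) (ℕP.*-comm 4 ∣ k ∣)))

-- A fundamental discriminant D ≠ 1 is not a rational square.  If D ≡ 1 (mod 4)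
-- it is squarefree; if D = 4m then (p/2)² = m would force m = 1, which is not
-- 2 or 3 modulo 4.
fundamental-nonsquare : ∀ {D} → FundamentalDiscriminant D → D ≢ + 1 → NonSquare D
fundamental-nonsquare (inj₁ (_ , sf)) D≢1 p p²≡D = D≢1 (squarefree-square {p} sf p²≡D)
fundamental-nonsquare (inj₂ (m , D≡4m , m-mod-4 , sf)) _ p p²≡D =
  m-not-one m-mod-4 (squarefree-square {p Q.* ½} sf half-square)
  where
  half-square : (p Q.* ½) Q.* (p Q.* ½) ≡ ι m
  half-square = begin
    (p Q.* ½) Q.* (p Q.* ½)      ≡⟨ solve 1 (λ p → (p :* con ½) :* (p :* con ½) := (p :* p) :* (con ½ :* con ½)) refl p ⟩
    (p Q.* p) Q.* (½ Q.* ½)      ≡⟨ cong (λ e → e Q.* (½ Q.* ½)) (trans p²≡D (trans (cong ι D≡4m) (ι-* (+ 4) m))) ⟩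
    (ι (+ 4) Q.* ι m) Q.* (½ Q.* ½) ≡⟨ solve 1 (λ m → (con (ι (+ 4)) :* m) :* (con ½ :* con ½) := m) refl (ι m) ⟩
    ι m                          ∎
  m-not-one : (∃ λ k → m ≡ + 4 ℤ.* k ℤ.+ + 2) ⊎ (∃ λ k → m ≡ + 4 ℤ.* k ℤ.+ + 3) → m ≢ + 1
  m-not-one (inj₁ (k , m≡4k+2)) m≡1 = not-one-mod-four k 0 (s≤s z≤n) (trans (sym m≡4k+2) m≡1)
  m-not-one (inj₂ (k , m≡4k+3)) m≡1 = not-one-mod-four k 1 (s≤s (s≤s z≤n)) (trans (sym m≡4k+3) m≡1)

module QuadraticField (D : ℤ) where

  private
    d = ι D
    _·_ = _*K_ D
    infixl 7 _·_

  N : K → ℚ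
  N = normK D

  K-≡ : ∀ {β γ : K} → re β ≡ re γ → im β ≡ im γ → β ≡ γ
  K-≡ = cong₂ _+√D·_

  scale : ℚ → K → K
  scale s β = (re β Q.* s) +√D· (im β Q.* s)

  -- Mirror of the operations of K on pairs of solver polynomials, so that the
  -- coordinates of identities in K can be handed to the ring solver for ℚ.
  KPoly : ℕ → Set
  KPoly n = Polynomial n × Polynomial n

  mulP : ∀ {n} → Polynomial n → KPoly n → KPoly n → KPoly n
  mulP δ (a , b) (c , e) = (a :* c :+ δ :* b :* e) , (a :* e :+ b :* c)

  τP : ∀ {n} → KPoly n → KPoly n
  τP (a , b) = a , :- b

  cubeP : ∀ {n} → Polynomial n → KPoly n → KPoly n
  cubeP δ z = mulP δ z (mulP δ z z)

  normP : ∀ {n} → Polynomial n → KPoly n → Polynomial n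
  normP δ v = proj₁ (mulP δ v (τP v))

  norm-expand : ∀ β → N β ≡ re β Q.* re β Q.- d Q.* im β Q.* im β
  norm-expand (a +√D· b) = solve 3 (λ a b δ → normP δ (a , b) := a :* a :- δ :* b :* b) refl a b d

  norm-* : ∀ β γ → N (β · γ) ≡ N β Q.* N γ
  norm-* (a +√D· b) (c +√D· e) =
    solve 5 (λ a b c e δ → normP δ (mulP δ (a , b) (c , e)) := normP δ (a , b) :* normP δ (c , e)) refl a b c e d

  norm-τ : ∀ β → N (τ D β) ≡ N β
  norm-τ (a +√D· b) = solve 3 (λ a b δ → normP δ (τP (a , b)) := normP δ (a , b)) refl a b d

  twisted-square : ∀ v q → (v · v) · τ D v · q ≡ scale (N v) (v · q)
  twisted-square (a +√D· b) (c +√D· e) = K-≡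
    (solve 5 (λ a b c e δ → proj₁ (mulP δ (mulP δ (mulP δ (a , b) (a , b)) (τP (a , b))) (c , e))
                              := proj₁ (mulP δ (a , b) (c , e)) :* normP δ (a , b)) refl a b c e d)
    (solve 5 (λ a b c e δ → proj₂ (mulP δ (mulP δ (mulP δ (a , b) (a , b)) (τP (a , b))) (c , e))
                              := proj₂ (mulP δ (a , b) (c , e)) :* normP δ (a , b)) refl a b c e d)

  scale-·ʳ : ∀ s β γ → β · scale s γ ≡ scale s (β · γ)
  scale-·ʳ s (a +√D· b) (c +√D· e) = K-≡
    (solve 6 (λ s a b c e δ → proj₁ (mulP δ (a , b) (c :* s , e :* s)) := proj₁ (mulP δ (a , b) (c , e)) :* s) refl s a b c e d)
    (solve 6 (λ s a b c e δ → proj₂ (mulP δ (a , b) (c :* s , e :* s)) := proj₂ (mulP δ (a , b) (c , e)) :* s) refl s a b c e d)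

  cube-scale : ∀ s β → cubeK D (scale s β) ≡ scale (s Q.* s Q.* s) (cubeK D β)
  cube-scale s (a +√D· b) = K-≡
    (solve 4 (λ s a b δ → proj₁ (cubeP δ (a :* s , b :* s)) := proj₁ (cubeP δ (a , b)) :* (s :* s :* s)) refl s a b d)
    (solve 4 (λ s a b δ → proj₂ (cubeP δ (a :* s , b :* s)) := proj₂ (cubeP δ (a , b)) :* (s :* s :* s)) refl s a b d)

  norm-twisted-cube : ∀ v z → N ((v · v) · τ D v · cubeK D z) ≡ (N v Q.* N z) Q.* (N v Q.* N z) Q.* (N v Q.* N z)
  norm-twisted-cube v z = begin
    N ((v · v) · τ D v · cubeK D z)             ≡⟨ norm-* ((v · v) · τ D v) (cubeK D z) ⟩
    N ((v · v) · τ D v) Q.* N (cubeK D z)       ≡⟨ cong₂ Q._*_ (trans (norm-* (v · v) (τ D v)) (cong₂ Q._*_ (norm-* v v) (norm-τ v)))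
                                                                (trans (norm-* z (z · z)) (cong (N z Q.*_) (norm-* z z))) ⟩
    N v Q.* N v Q.* N v Q.* (N z Q.* (N z Q.* N z)) ≡⟨ solve 2 (λ p q → p :* p :* p :* (q :* (q :* q)) := (p :* q) :* (p :* q) :* (p :* q)) refl (N v) (N z) ⟩
    (N v Q.* N z) Q.* (N v Q.* N z) Q.* (N v Q.* N z) ∎

  -- When D is not a rational square, nonzero elements have nonzero norm:
  -- β₁² = D β₂² with β₂ ≠ 0 would make (β₁/β₂)² = D.
  norm-≢0 : NonSquare D → ∀ {β} → β ≢ 0K → N β ≢ 0ℚ
  norm-≢0 nonsq {a +√D· b} β≢0 Nβ≡0 with b QP.≟ 0ℚ
  ... | yes b≡0 = β≢0 (K-≡ (square-zero a²≡0) b≡0)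
    where
    a²≡0 : a Q.* a ≡ 0ℚ
    a²≡0 = begin
      a Q.* a                                  ≡⟨ solve 3 (λ a b δ → a :* a := normP δ (a , b) :+ δ :* b :* b) refl a b d ⟩
      N (a +√D· b) Q.+ d Q.* b Q.* b           ≡⟨ cong₂ (λ n e → n Q.+ d Q.* e Q.* e) Nβ≡0 b≡0 ⟩
      0ℚ Q.+ d Q.* 0ℚ Q.* 0ℚ                   ≡⟨ solve 1 (λ δ → con 0ℚ :+ δ :* con 0ℚ :* con 0ℚ := con 0ℚ) refl d ⟩
      0ℚ                                       ∎
  ... | no b≢0 = nonsq (a Q.* i) (begin
      (a Q.* i) Q.* (a Q.* i)                  ≡⟨ solve 4 (λ a b δ i → (a :* i) :* (a :* i) := normP δ (a , b) :* (i :* i) :+ δ :* ((b :* i) :* (b :* i))) refl a b d i ⟩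
      N (a +√D· b) Q.* (i Q.* i) Q.+ d Q.* ((b Q.* i) Q.* (b Q.* i)) ≡⟨ cong₂ (λ n e → n Q.* (i Q.* i) Q.+ d Q.* (e Q.* e)) Nβ≡0 (inv0-inverse b≢0) ⟩
      0ℚ Q.* (i Q.* i) Q.+ d Q.* (1ℚ Q.* 1ℚ)   ≡⟨ solve 2 (λ i δ → con 0ℚ :* (i :* i) :+ δ :* (con 1ℚ :* con 1ℚ) := δ) refl i d ⟩
      d                                        ∎)
    where i = inv0 b

module Descent (a b D : ℤ) where
  open Curve a b D
  open QuadraticField D

  private
    d = ι D
    A = ι a
    B = ι b
    _·_ = _*K_ D
    infixl 7 _·_

  twist : K → K
  twist v = (v · v) · τ D v

  -- Mirror of Cubic for the ring solver; i stands for the inverse of N(v).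
  cubicP : ∀ {n} → (v₁ v₂ X Y Z δ α β i : Polynomial n) → Polynomial n
  cubicP v₁ v₂ X Y Z δ α β i =
        con (ι (+ 2)) :* v₂ :* (X :* X :* X)
    :+ con (ι (+ 2)) :* δ :* v₁ :* (Y :* Y :* Y)
    :+ (con (ι (+ 2)) :* β) :* i :* (Z :* Z :* Z)
    :+ con (ι (+ 6)) :* v₁ :* (X :* X :* Y)
    :+ con (ι (+ 6)) :* v₂ :* δ :* (X :* Y :* Y)
    :+ con (ι (+ 2)) :* α :* (X :* X :* Z :- δ :* (Y :* Y :* Z))

  cubic-homogeneous : ∀ v X Y Z m → Cubic v (X Q.* m) (Y Q.* m) (Z Q.* m) ≡ m Q.* m Q.* m Q.* Cubic v X Y Z
  cubic-homogeneous (v₁ +√D· v₂) X Y Z m =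
    solve 10 (λ v₁ v₂ X Y Z m δ α β i →
                cubicP v₁ v₂ (X :* m) (Y :* m) (Z :* m) δ α β i := m :* m :* m :* cubicP v₁ v₂ X Y Z δ α β i)
      refl v₁ v₂ X Y Z m d A B (inv0 (v₁ Q.* v₁ Q.- d Q.* v₂ Q.* v₂))

  -- The key identity: with w = X + Y√D,
  --   N(v) · Cubic(v; X, Y, Z) = 2 (Im(u w³) + a Z N(v) N(w) + b Z³).
  -- It only uses that the coefficient 1/(v₁² − D v₂²) inverts N(v).
  scaled-cubic : ∀ v → N v ≢ 0ℚ → ∀ X Y Z →
                 N v Q.* Cubic v X Y Z
                   ≡ ι (+ 2) Q.* (im (twist v · cubeK D (X +√D· Y)) Q.+ (A Q.* Z Q.* (N v Q.* N (X +√D· Y)) Q.+ B Q.* (Z Q.* Z Q.* Z)))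
  scaled-cubic v@(v₁ +√D· v₂) Nv≢0 X Y Z = begin
    N v Q.* Cubic v X Y Z
      ≡⟨ solve 9 (λ v₁ v₂ X Y Z δ α β i →
                    let Nv = normP δ (v₁ , v₂)
                        Z³ = Z :* Z :* Z
                        Iu = proj₂ (mulP δ (mulP δ (mulP δ (v₁ , v₂) (v₁ , v₂)) (τP (v₁ , v₂))) (cubeP δ (X , Y)))
                    in Nv :* cubicP v₁ v₂ X Y Z δ α β i
                       := con (ι (+ 2)) :* (Iu :+ (α :* Z :* (Nv :* normP δ (X , Y)) :+ β :* Z³))
                          :+ con (ι (+ 2)) :* (β :* Z³) :* (Nv :* i :- con 1ℚ))
           refl v₁ v₂ X Y Z d A B i ⟩
    correction (N v Q.* i)  ≡⟨ cong correction N·i≡1 ⟩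
    correction 1ℚ           ≡⟨ solve 3 (λ I r c → con (ι (+ 2)) :* (I :+ r) :+ con (ι (+ 2)) :* c :* (con 1ℚ :- con 1ℚ)
                                                  := con (ι (+ 2)) :* (I :+ r)) refl I rest (B Q.* (Z Q.* Z Q.* Z)) ⟩
    ι (+ 2) Q.* (I Q.+ rest) ∎
    where
    i = inv0 (v₁ Q.* v₁ Q.- d Q.* v₂ Q.* v₂)
    I = im (twist v · cubeK D (X +√D· Y))
    rest = A Q.* Z Q.* (N v Q.* N (X +√D· Y)) Q.+ B Q.* (Z Q.* Z Q.* Z)
    -- the b Z³ coefficient, off by a factor t − 1 that vanishes when t = N(v) · i = 1
    correction : ℚ → ℚ
    correction t = ι (+ 2) Q.* (I Q.+ rest) Q.+ ι (+ 2) Q.* (B Q.* (Z Q.* Z Q.* Z)) Q.* (t Q.- 1ℚ)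
    N·i≡1 : N v Q.* i ≡ 1ℚ
    N·i≡1 = trans (cong (Q._* i) (norm-expand v))
                  (inv0-inverse (λ e → Nv≢0 (trans (norm-expand v) e)))

  cubic-at-infinity : ∀ v → N v ≢ 0ℚ → ∀ X Y →
                      Cubic v X Y 0ℚ ≡ 0ℚ ⇔ im (twist v · cubeK D (X +√D· Y)) ≡ 0ℚ
  cubic-at-infinity v Nv≢0 X Y = mk⇔
    (λ C≡0 → cancel-≢0 {ι (+ 2)} (λ ()) (trans (sym identity) (trans (cong (N v Q.*_) C≡0) (QP.*-zeroʳ (N v)))))
    (λ I≡0 → cancel-≢0 Nv≢0 (trans identity (cong (ι (+ 2) Q.*_) I≡0)))
    where
    I = im (twist v · cubeK D (X +√D· Y))
    identity : N v Q.* Cubic v X Y 0ℚ ≡ ι (+ 2) Q.* I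
    identity = trans (scaled-cubic v Nv≢0 X Y 0ℚ)
      (solve 4 (λ I α β M → con (ι (+ 2)) :* (I :+ (α :* con 0ℚ :* M :+ β :* (con 0ℚ :* con 0ℚ :* con 0ℚ)))
                              := con (ι (+ 2)) :* I) refl I A B (N v Q.* N (X +√D· Y)))

  affine-cubic : ∀ v → N v ≢ 0ℚ → ∀ z →
                 Cubic v (re z) (im z) 1ℚ ≡ 0ℚ ⇔ im (twist v · cubeK D z) ≡ Q.- (A Q.* (N v Q.* N z) Q.+ B)
  affine-cubic v Nv≢0 z = mk⇔
    (λ C≡0 → inverseˡ-unique I T (cancel-≢0 {ι (+ 2)} (λ ())
               (trans (sym identity) (trans (cong (N v Q.*_) C≡0) (QP.*-zeroʳ (N v))))))
    (λ I≡-T → cancel-≢0 Nv≢0 (trans identity (cong (ι (+ 2) Q.*_)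
               (trans (cong (Q._+ T) I≡-T) (QP.+-inverseˡ T)))))
    where
    I = im (twist v · cubeK D z)
    T = A Q.* (N v Q.* N z) Q.+ B
    identity : N v Q.* Cubic v (re z) (im z) 1ℚ ≡ ι (+ 2) Q.* (I Q.+ T)
    identity = trans (scaled-cubic v Nv≢0 (re z) (im z) 1ℚ)
      (solve 4 (λ I α β M → con (ι (+ 2)) :* (I :+ (α :* con 1ℚ :* M :+ β :* (con 1ℚ :* con 1ℚ :* con 1ℚ)))
                              := con (ι (+ 2)) :* (I :+ (α :* M :+ β))) refl I A B (N v Q.* N z))

  twist-cube-zero : ∀ v → twist v · cubeK D 0K ≡ 0K
  twist-cube-zero (v₁ +√D· v₂) = K-≡
    (solve 3 (λ v₁ v₂ δ → proj₁ (mulP δ (mulP δ (mulP δ (v₁ , v₂) (v₁ , v₂)) (τP (v₁ , v₂))) (cubeP δ (con 0ℚ , con 0ℚ))) := con 0ℚ) refl v₁ v₂ d)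
    (solve 3 (λ v₁ v₂ δ → proj₂ (mulP δ (mulP δ (mulP δ (v₁ , v₂) (v₁ , v₂)) (τP (v₁ , v₂))) (cubeP δ (con 0ℚ , con 0ℚ))) := con 0ℚ) refl v₁ v₂ d)

  twist-cube-scale : ∀ v s w → twist v · cubeK D (scale s w) ≡ scale (s Q.* s Q.* s) (twist v · cubeK D w)
  twist-cube-scale v s w = trans (cong (twist v ·_) (cube-scale s w)) (scale-·ʳ (s Q.* s Q.* s) (twist v) (cubeK D w))

  -- N(α(x, y)) = y² − D (ax + b)², so (x, y) lies on E exactly when N(α(x, y)) = x³.
  on-curve⇔norm : ∀ x y → OnE x y ⇔ N (αxy x y) ≡ x Q.* x Q.* x
  on-curve⇔norm x y = mk⇔
    (λ onE → begin
      N (αxy x y)                                   ≡⟨ norm-α ⟩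
      y Q.* y Q.- d Q.* (t Q.* t)                   ≡⟨ cong (Q._- d Q.* (t Q.* t)) onE ⟩
      x Q.* x Q.* x Q.+ d Q.* (t Q.* t) Q.- d Q.* (t Q.* t) ≡⟨ solve 3 (λ x t δ → x :* x :* x :+ δ :* (t :* t) :- δ :* (t :* t) := x :* x :* x) refl x t d ⟩
      x Q.* x Q.* x                                 ∎)
    (λ Nα≡x³ → begin
      y Q.* y                                       ≡⟨ solve 3 (λ y t δ → y :* y := (y :* y :- δ :* (t :* t)) :+ δ :* (t :* t)) refl y t d ⟩
      (y Q.* y Q.- d Q.* (t Q.* t)) Q.+ d Q.* (t Q.* t) ≡⟨ cong (Q._+ d Q.* (t Q.* t)) (trans (sym norm-α) Nα≡x³) ⟩
      x Q.* x Q.* x Q.+ d Q.* (t Q.* t)             ∎)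
    where
    t = A Q.* x Q.+ B
    norm-α : N (αxy x y) ≡ y Q.* y Q.- d Q.* (t Q.* t)
    norm-α = solve 3 (λ y t δ → normP δ (y , :- t) := y :* y :- δ :* (t :* t)) refl y t d

  -- If α(x, y) = u z³ on E then x = N(v) N(z): the norms give x³ = (N(v) N(z))³.
  abscissa : ∀ {x y v z} → OnE x y → αxy x y ≡ twist v · cubeK D z → x ≡ N v Q.* N z
  abscissa {x} {y} {v} {z} onE α≡uz³ = cube-injective (begin
    x Q.* x Q.* x               ≡⟨ sym (Equivalence.to (on-curve⇔norm x y) onE) ⟩
    N (αxy x y)                 ≡⟨ cong N α≡uz³ ⟩
    N (twist v · cubeK D z)     ≡⟨ norm-twisted-cube v z ⟩
    (N v Q.* N z) Q.* (N v Q.* N z) Q.* (N v Q.* N z) ∎)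

  -- For b ≠ 0 the map α never takes the value 0 on E: α(x, y) = 0 gives x³ = 0
  -- and then b = −Im α(x, y) = 0.
  α-≢0 : B ≢ 0ℚ → ∀ {x y} → OnE x y → αxy x y ≢ 0K
  α-≢0 B≢0 {x} {y} onE α≡0 = B≢0 (QP.neg-injective (begin
    Q.- B                       ≡⟨ solve 2 (λ α β → :- β := :- (α :* con 0ℚ :+ β)) refl A B ⟩
    Q.- (A Q.* 0ℚ Q.+ B)        ≡⟨ cong (λ e → Q.- (A Q.* e Q.+ B)) (sym x≡0) ⟩
    Q.- (A Q.* x Q.+ B)         ≡⟨ cong im α≡0 ⟩
    Q.- 0ℚ                      ∎))
    where
    x≡0 : x ≡ 0ℚ
    x≡0 = cube-injective (trans (sym (Equivalence.to (on-curve⇔norm x y) onE))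
            (trans (cong N α≡0) (solve 1 (λ δ → normP δ (con 0ℚ , con 0ℚ) := con 0ℚ) refl d)))

  cubic-dehomogenise : ∀ v X Y {Z} → Z ≢ 0ℚ →
                       Cubic v X Y Z ≡ Z Q.* Z Q.* Z Q.* Cubic v (X Q.* inv0 Z) (Y Q.* inv0 Z) 1ℚ
  cubic-dehomogenise v X Y {Z} Z≢0 = begin
    Cubic v X Y Z                                          ≡⟨ cong₂ (λ X′ Y′ → Cubic v X′ Y′ Z) (sym (inv0-cancel Z≢0 X)) (sym (inv0-cancel Z≢0 Y)) ⟩
    Cubic v (X Q.* inv0 Z Q.* Z) (Y Q.* inv0 Z Q.* Z) Z     ≡⟨ cong (Cubic v (X Q.* inv0 Z Q.* Z) (Y Q.* inv0 Z Q.* Z)) (sym (QP.*-identityˡ Z)) ⟩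
    Cubic v (X Q.* inv0 Z Q.* Z) (Y Q.* inv0 Z Q.* Z) (1ℚ Q.* Z) ≡⟨ cubic-homogeneous v (X Q.* inv0 Z) (Y Q.* inv0 Z) 1ℚ Z ⟩
    Z Q.* Z Q.* Z Q.* Cubic v (X Q.* inv0 Z) (Y Q.* inv0 Z) 1ℚ ∎

  unit-solution : Cubic 1K 1ℚ 0ℚ 0ℚ ≡ 0ℚ
  unit-solution = solve 4 (λ δ α β i → cubicP (con 1ℚ) (con 0ℚ) (con 1ℚ) (con 0ℚ) (con 0ℚ) δ α β i := con 0ℚ)
                    refl d A B (inv0 (1ℚ Q.* 1ℚ Q.- d Q.* 0ℚ Q.* 0ℚ))

  -- Integral and rational solutions are the same thing: clearing the three
  -- denominators multiplies the cubic by the nonzero cube M³, M = ↧X ↧Y ↧Z.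
  integral⇔rational : ∀ v → HasIntSol v ⇔ HasRatSol v
  integral⇔rational v = mk⇔ integral→rational rational→integral
    where
    integral→rational : HasIntSol v → HasRatSol v
    integral→rational (X , Y , Z , nontrivial , C≡0) =
      ι X , ι Y , ι Z ,
      (λ (X≡0 , Y≡0 , Z≡0) → nontrivial (ι-injective X≡0 , ι-injective Y≡0 , ι-injective Z≡0)) , C≡0
    rational→integral : HasRatSol v → HasIntSol v
    rational→integral (X , Y , Z , nontrivial , C≡0) = X′ , Y′ , Z′ , nontrivial′ , C′≡0
      where
      M = ι (↧ X) Q.* ι (↧ Y) Q.* ι (↧ Z)
      M≢0 : M ≢ 0ℚ
      M≢0 = *-≢0 (*-≢0 (ι-denominator-≢0 X) (ι-denominator-≢0 Y)) (ι-denominator-≢0 Z)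
      ι-*₃ : ∀ i j k → ι (i ℤ.* j ℤ.* k) ≡ ι i Q.* ι j Q.* ι k
      ι-*₃ i j k = trans (ι-* (i ℤ.* j) k) (cong (Q._* ι k) (ι-* i j))
      X′ = ↥ X ℤ.* ↧ Y ℤ.* ↧ Z
      Y′ = ↧ X ℤ.* ↥ Y ℤ.* ↧ Z
      Z′ = ↧ X ℤ.* ↧ Y ℤ.* ↥ Z
      X′≡XM : ι X′ ≡ X Q.* M
      X′≡XM = trans (ι-*₃ (↥ X) (↧ Y) (↧ Z)) (trans (cong (λ e → e Q.* ι (↧ Y) Q.* ι (↧ Z)) (sym (ι-denominator X)))
        (solve 4 (λ p a b c → p :* a :* b :* c := p :* (a :* b :* c)) refl X (ι (↧ X)) (ι (↧ Y)) (ι (↧ Z))))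
      Y′≡YM : ι Y′ ≡ Y Q.* M
      Y′≡YM = trans (ι-*₃ (↧ X) (↥ Y) (↧ Z)) (trans (cong (λ e → ι (↧ X) Q.* e Q.* ι (↧ Z)) (sym (ι-denominator Y)))
        (solve 4 (λ p a b c → a :* (p :* b) :* c := p :* (a :* b :* c)) refl Y (ι (↧ X)) (ι (↧ Y)) (ι (↧ Z))))
      Z′≡ZM : ι Z′ ≡ Z Q.* M
      Z′≡ZM = trans (ι-*₃ (↧ X) (↧ Y) (↥ Z)) (trans (cong (λ e → ι (↧ X) Q.* ι (↧ Y) Q.* e) (sym (ι-denominator Z)))
        (solve 4 (λ p a b c → a :* b :* (p :* c) := p :* (a :* b :* c)) refl Z (ι (↧ X)) (ι (↧ Y)) (ι (↧ Z))))
      vanishes : ∀ {p i} → ι i ≡ p Q.* M → i ≡ + 0 → p ≡ 0ℚ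
      vanishes {p} ι≡pM i≡0 = cancel-≢0 M≢0 (trans (QP.*-comm M p) (trans (sym ι≡pM) (cong ι i≡0)))
      nontrivial′ : ¬ (X′ ≡ + 0 × Y′ ≡ + 0 × Z′ ≡ + 0)
      nontrivial′ (X′≡0 , Y′≡0 , Z′≡0) =
        nontrivial (vanishes X′≡XM X′≡0 , vanishes Y′≡YM Y′≡0 , vanishes Z′≡ZM Z′≡0)
      C′≡0 : Cubic v (ι X′) (ι Y′) (ι Z′) ≡ 0ℚ
      C′≡0 = begin
        Cubic v (ι X′) (ι Y′) (ι Z′)                ≡⟨ cong₂ (λ X″ Y″ → Cubic v X″ Y″ (ι Z′)) X′≡XM Y′≡YM ⟩
        Cubic v (X Q.* M) (Y Q.* M) (ι Z′)          ≡⟨ cong (Cubic v (X Q.* M) (Y Q.* M)) Z′≡ZM ⟩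
        Cubic v (X Q.* M) (Y Q.* M) (Z Q.* M)       ≡⟨ cubic-homogeneous v X Y Z M ⟩
        M Q.* M Q.* M Q.* Cubic v X Y Z              ≡⟨ cong (M Q.* M Q.* M Q.*_) C≡0 ⟩
        M Q.* M Q.* M Q.* 0ℚ                        ≡⟨ QP.*-zeroʳ (M Q.* M Q.* M) ⟩
        0ℚ                                          ∎

  -- From here on D is not a rational square, so N(v) ≠ 0 for every v ≠ 0
  -- (norm-≢0) and the cubic of v is governed by scaled-cubic.
  module Nonsquare (nonsq : NonSquare D) where

    solution-from-point : ∀ {v} → v ≢ 0K → ∀ {x y} → OnE x y → ∀ {z} →
                          αxy x y ≡ twist v · cubeK D z → Cubic v (re z) (im z) 1ℚ ≡ 0ℚ
    solution-from-point {v} v≢0 onE {z} α≡uz³ =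
      Equivalence.from (affine-cubic v (norm-≢0 nonsq v≢0) z)
        (trans (cong im (sym α≡uz³)) (cong (λ e → Q.- (A Q.* e Q.+ B)) (abscissa {v = v} {z = z} onE α≡uz³)))

    point-from-solution : ∀ {v} → v ≢ 0K → ∀ z → Cubic v (re z) (im z) 1ℚ ≡ 0ℚ →
                          let x = N v Q.* N z
                              y = re (twist v · cubeK D z)
                          in OnE x y × αxy x y ≡ twist v · cubeK D z
    point-from-solution {v} v≢0 z C≡0 = on-curve , α≡uz³
      where
      α≡uz³ : αxy (N v Q.* N z) (re (twist v · cubeK D z)) ≡ twist v · cubeK D z
      α≡uz³ = K-≡ refl (sym (Equivalence.to (affine-cubic v (norm-≢0 nonsq v≢0) z) C≡0))
      on-curve : OnE (N v Q.* N z) (re (twist v · cubeK D z))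
      on-curve = Equivalence.from (on-curve⇔norm (N v Q.* N z) (re (twist v · cubeK D z))) (trans (cong N α≡uz³) (norm-twisted-cube v z))

    -- (2c) A solution with Z ≠ 0 yields the point of E displayed in the theorem,
    -- mapped by α to u z³ with z = (X + Y√D)/Z: it is the point of
    -- point-from-solution for the dehomogenised solution z.
    point-from-projective-solution :
      ∀ {v} → v ≢ 0K → ∀ X Y Z → Z ≢ 0ℚ → Cubic v X Y Z ≡ 0ℚ →
      let x = N v Q.* ((X Q.* X Q.- d Q.* Y Q.* Y) Q.* inv0 (Z Q.* Z))
          y = N v Q.* (ℜ D (v · cubeK D (X +√D· Y)) Q.* inv0 (Z Q.* Z Q.* Z))
          z = (X Q.* inv0 Z) +√D· (Y Q.* inv0 Z)
      in OnE x y × αxy x y ≡ twist v · cubeK D z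
    point-from-projective-solution {v} v≢0 X Y Z Z≢0 C≡0 =
      subst₂ (λ x y → OnE x y × αxy x y ≡ twist v · cubeK D z) (sym x≡) (sym y≡)
        (point-from-solution v≢0 z affine-solution)
      where
      w = X +√D· Y
      iZ = inv0 Z
      z = scale iZ w
      Z³≢0 : Z Q.* Z Q.* Z ≢ 0ℚ
      Z³≢0 = *-≢0 (*-≢0 Z≢0 Z≢0) Z≢0
      affine-solution : Cubic v (re z) (im z) 1ℚ ≡ 0ℚ
      affine-solution = cancel-≢0 Z³≢0 (trans (sym (cubic-dehomogenise v X Y Z≢0)) C≡0)
      x≡ : N v Q.* ((X Q.* X Q.- d Q.* Y Q.* Y) Q.* inv0 (Z Q.* Z)) ≡ N v Q.* N z
      x≡ = begin
        N v Q.* ((X Q.* X Q.- d Q.* Y Q.* Y) Q.* inv0 (Z Q.* Z)) ≡⟨ cong (λ e → N v Q.* ((X Q.* X Q.- d Q.* Y Q.* Y) Q.* e)) (inv0-* Z≢0 Z≢0) ⟩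
        N v Q.* ((X Q.* X Q.- d Q.* Y Q.* Y) Q.* (iZ Q.* iZ))   ≡⟨ solve 5 (λ n X Y i δ → n :* ((X :* X :- δ :* Y :* Y) :* (i :* i)) := n :* normP δ (X :* i , Y :* i)) refl (N v) X Y iZ d ⟩
        N v Q.* N z                                            ∎
      R = re (v · cubeK D w)
      y≡ : N v Q.* (ℜ D (v · cubeK D w) Q.* inv0 (Z Q.* Z Q.* Z)) ≡ re (twist v · cubeK D z)
      y≡ = begin
        N v Q.* (ℜ D (v · cubeK D w) Q.* inv0 (Z Q.* Z Q.* Z))  ≡⟨ cong (λ e → N v Q.* (ℜ D (v · cubeK D w) Q.* e))
                                                                       (trans (inv0-* (*-≢0 Z≢0 Z≢0) Z≢0) (cong (Q._* iZ) (inv0-* Z≢0 Z≢0))) ⟩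
        N v Q.* (½ Q.* (R Q.+ R) Q.* (iZ Q.* iZ Q.* iZ))       ≡⟨ solve 3 (λ n R i → n :* (con ½ :* (R :+ R) :* i) := R :* n :* i) refl (N v) R (iZ Q.* iZ Q.* iZ) ⟩
        R Q.* N v Q.* (iZ Q.* iZ Q.* iZ)                         ≡⟨ cong (λ β → re β Q.* (iZ Q.* iZ Q.* iZ)) (sym (twisted-square v (cubeK D w))) ⟩
        re (twist v · cubeK D w) Q.* (iZ Q.* iZ Q.* iZ)          ≡⟨ cong re (sym (twist-cube-scale v iZ w)) ⟩
        re (twist v · cubeK D z)                                 ∎

    -- A solution at infinity makes u w³ = q a nonzero rational with
    -- q² = N(u w³) = c³, c = N(v) N(w); then q = s³ for s = q/c, and
    -- w′ = w/s satisfies u w′³ = 1 = α(O).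
    point-at-infinity : ∀ {v w} → v ≢ 0K → w ≢ 0K → im (twist v · cubeK D w) ≡ 0ℚ →
                        ∃ λ w′ → w′ ≢ 0K × 1K ≡ twist v · cubeK D w′
    point-at-infinity {v} {w} v≢0 w≢0 Im≡0 = w′ , w′≢0 , 1≡uw′³
      where
      β = twist v · cubeK D w
      q = re β
      c = N v Q.* N w
      c³≢0 : c Q.* c Q.* c ≢ 0ℚ
      c³≢0 = let c≢0 = *-≢0 (norm-≢0 nonsq v≢0) (norm-≢0 nonsq w≢0) in *-≢0 (*-≢0 c≢0 c≢0) c≢0
      q²≡c³ : q Q.* q ≡ c Q.* c Q.* c
      q²≡c³ = begin
        q Q.* q                            ≡⟨ solve 2 (λ q δ → q :* q := q :* q :- δ :* con 0ℚ :* con 0ℚ) refl q d ⟩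
        q Q.* q Q.- d Q.* 0ℚ Q.* 0ℚ         ≡⟨ cong (λ e → q Q.* q Q.- d Q.* e Q.* e) (sym Im≡0) ⟩
        q Q.* q Q.- d Q.* im β Q.* im β     ≡⟨ sym (norm-expand β) ⟩
        N β                                ≡⟨ norm-twisted-cube v w ⟩
        c Q.* c Q.* c                      ∎
      s = q Q.* inv0 c
      s³≡q : s Q.* s Q.* s ≡ q
      s³≡q = cube-root {q} {c} (λ c≡0 → c³≢0 (cong (λ e → e Q.* e Q.* e) c≡0)) q²≡c³
      s≢0 : s ≢ 0ℚ
      s≢0 s≡0 = c³≢0 (trans (sym q²≡c³) (cong (λ e → e Q.* e) (trans (sym s³≡q) (cong (λ e → e Q.* e Q.* e) s≡0))))
      is = inv0 s
      w′ = scale is w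
      1≡uw′³ : 1K ≡ twist v · cubeK D w′
      1≡uw′³ = sym (trans (twist-cube-scale v is w) (K-≡ re≡1 im≡0))
        where
        re≡1 : q Q.* (is Q.* is Q.* is) ≡ 1ℚ
        re≡1 = begin
          q Q.* (is Q.* is Q.* is)               ≡⟨ cong (Q._* (is Q.* is Q.* is)) (sym s³≡q) ⟩
          s Q.* s Q.* s Q.* (is Q.* is Q.* is)   ≡⟨ solve 2 (λ s i → s :* s :* s :* (i :* i :* i) := (s :* i) :* (s :* i) :* (s :* i)) refl s is ⟩
          (s Q.* is) Q.* (s Q.* is) Q.* (s Q.* is) ≡⟨ cong (λ e → e Q.* e Q.* e) (inv0-inverse s≢0) ⟩
          1ℚ                                     ∎
        im≡0 : im β Q.* (is Q.* is Q.* is) ≡ 0ℚ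
        im≡0 = trans (cong (Q._* (is Q.* is Q.* is)) Im≡0) (QP.*-zeroˡ (is Q.* is Q.* is))
      w′≢0 : w′ ≢ 0K
      w′≢0 w′≡0 = QP.1≢0 (cong re (trans 1≡uw′³ (trans (cong (λ e → twist v · cubeK D e) w′≡0) (twist-cube-zero v))))

    -- (1, ⇒) A preimage of [u] gives a nontrivial solution: α(O) = 1 = u w³
    -- gives the solution (w₁, w₂, 0) at infinity, an affine point gives (w₁, w₂, 1).
    solution-from-preimage : ∀ {v} → v ≢ 0K → InImage (twist v) → HasRatSol v
    solution-from-preimage {v} v≢0 (O , w , w≢0 , 1≡uw³) =
      re w , im w , 0ℚ , (λ (w₁≡0 , w₂≡0 , _) → w≢0 (K-≡ w₁≡0 w₂≡0)) ,
      Equivalence.from (cubic-at-infinity v (norm-≢0 nonsq v≢0) (re w) (im w)) (sym (cong im 1≡uw³))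
    solution-from-preimage v≢0 (aff x y onE , w , _ , α≡uw³) =
      re w , im w , 1ℚ , (λ (_ , _ , 1≡0) → QP.1≢0 1≡0) , solution-from-point v≢0 onE {w} α≡uw³

    -- (1, ⇐) A nontrivial solution gives a preimage of [u]: O if Z = 0
    -- (point-at-infinity), and the point of (2c) otherwise; there z ≠ 0
    -- because α does not vanish on E.
    preimage-from-solution : B ≢ 0ℚ → ∀ {v} → v ≢ 0K → HasRatSol v → InImage (twist v)
    preimage-from-solution B≢0 {v} v≢0 (X , Y , Z , nontrivial , C≡0) with Z QP.≟ 0ℚ
    ... | yes Z≡0 = O , point-at-infinity v≢0 w≢0
                          (Equivalence.to (cubic-at-infinity v (norm-≢0 nonsq v≢0) X Y) (subst (λ e → Cubic v X Y e ≡ 0ℚ) Z≡0 C≡0))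
      where
      w≢0 : X +√D· Y ≢ 0K
      w≢0 w≡0 = nontrivial (cong re w≡0 , cong im w≡0 , Z≡0)
    ... | no Z≢0 = aff _ _ on-curve , _ , z≢0 , α≡uz³
      where
      point = point-from-projective-solution v≢0 X Y Z Z≢0 C≡0
      on-curve = proj₁ point
      α≡uz³ = proj₂ point
      z≢0 : (X Q.* inv0 Z) +√D· (Y Q.* inv0 Z) ≢ 0K
      z≢0 z≡0 = α-≢0 B≢0 on-curve (trans α≡uz³ (trans (cong (λ e → twist v · cubeK D e) z≡0) (twist-cube-zero v)))

theorem4p1 :
  (a b D : ℤ) →
  FundamentalDiscriminant D → D ≢ + 1 → b > + 0 →
  + 4 * D * a ^ 3 ≢ + 27 * b →
  (∃ λ (b₁ : ℕ) → ∃ λ (b₃ : ℕ) → CubeFree b₁ × b ≡ + b₁ * (+ b₃) ^ 3 × gcd ∣ a ∣ b₃ ≡ 1) →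
  let open Curve a b D in
  -- (1) for every v ∈ K*, with u = v²τ(v):
  ((v : K) → ¬ v ≡ 0K →
    (InImage (_*K_ D (_*K_ D v v) (τ D v)) ⇔ HasRatSol v)
    × (InImage (_*K_ D (_*K_ D v v) (τ D v)) ⇔ HasIntSol v))
  -- (2a) for v = 1 the cubic has the solution (1,0,0)
  × Cubic 1K 1ℚ 0ℚ 0ℚ ≡ 0ℚ
  -- (2b) a point (x,y) with y − (ax+b)√D = v²τ(v) z³ gives the solution (z₁,z₂,1)
  × ((v : K) → ¬ v ≡ 0K → (x y : ℚ) → OnE x y → (z : K) → ¬ z ≡ 0K →
      αxy x y ≡ _*K_ D (_*K_ D (_*K_ D v v) (τ D v)) (cubeK D z) →
      Cubic v (re z) (im z) 1ℚ ≡ 0ℚ)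
  -- (2c) a solution with Z ≠ 0 gives a preimage
  × ((v : K) → ¬ v ≡ 0K → (X Y Z : ℚ) → ¬ Z ≡ 0ℚ → Cubic v X Y Z ≡ 0ℚ →
      let N = normK D v
          x = N Q.* ((X Q.* X Q.- ι D Q.* Y Q.* Y) Q.* inv0 (Z Q.* Z))
          y = N Q.* (ℜ D (_*K_ D v (cubeK D (X +√D· Y))) Q.* inv0 (Z Q.* Z Q.* Z))
          z = (X Q.* inv0 Z) +√D· (Y Q.* inv0 Z)
      in OnE x y × αxy x y ≡ _*K_ D (_*K_ D (_*K_ D v v) (τ D v)) (cubeK D z))
theorem4p1 a b D fundamental D≢1 b>0 _ _ =
  (λ v v≢0 → let image⇔rational = mk⇔ (solution-from-preimage v≢0) (preimage-from-solution b≢0 v≢0)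
             in image⇔rational , ⇔-sym (integral⇔rational v) ⇔-∘ image⇔rational)
  , unit-solution
  , (λ v v≢0 x y on-curve z _ α≡uz³ → solution-from-point v≢0 on-curve {z} α≡uz³)
  , (λ v v≢0 → point-from-projective-solution v≢0)
  where
  open Descent a b D
  open Descent.Nonsquare a b D (fundamental-nonsquare fundamental D≢1)
  b≢0 : ι b ≢ 0ℚ
  b≢0 b≡0 = ℤP.<-irrefl refl (subst (+ 0 ℤ.<_) (ι-injective b≡0) b>0)
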